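{- Let $X\subseteq\omega$ be an infinite set with uniqueness of sums, let $u\in\beta\omega$ and let $\langle u_n : n<\omega\rangle$ be a sequence of ultrafilters on $\omega$. If $u$ and each $u_n$ are $X$-adequate, then $\bigoplus_u u_n$ is $X$-adequate.
   Context: For $A\subseteq\omega$, $\mathrm{FS}(A)$ is the set of sums $\sum_{a\in F}a$ over finite nonempty $F\subseteq A$. A set $A\subseteq\omega$ has uniqueness of sums if whenever $a_1<\dots<a_n$ and $b_1<\dots<b_m$ are elements of $A$ with $a_1+\dots+a_n=b_1+\dots+b_m$, then $n=m$ and $a_i=b_i$ for all $i$. For an infinite $X\subseteq\omega$ with increasing enumeration $\langle x_n : n<\omega\rangle$, a set $A\subseteq\omega$ is $X$-adequate if $A\subseteq\mathrm{FS}(X)$ and for every subsequence $\langle x_{n_k} : k\ge1\rangle$ ($n_1<n_2<\cdots$) there is a unique $m\ge1$ with $x_{n_1}+\dots+x_{n_m}\in A$. An ultrafilter $u$ on $\omega$ is $X$-adequate if some $X$-adequate set belongs to $u$ and $\mathrm{FS}(Y)\in u$ for every cofinite $Y\subseteq X$. For $u\in\beta\omega$ and ultrafilters $u_n$ on $\omega$, $\bigoplus_u u_n=\{A\subseteq\omega : \{n : \{m : n+m\in A\}\in u_n\}\in u\}$ (the image of the Blass–Frolík sum under $(n,m)\mapsto n+m$). -}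

module Defs where

open import Data.Nat using (ℕ; zero; suc; _+_; _≤_; _<_)
open import Data.List using (List; []; _∷_)
open import Data.Nat.ListAction using (sum)
open import Data.List.Relation.Unary.All using (All)
open import Data.List.Relation.Unary.Linked using (Linked)
open import Data.Product using (Σ; ∃; _×_; _,_)
open import Data.Sum using (_⊎_)
open import Data.Empty using (⊥)
open import Data.Unit using (⊤)
open import Relation.Nullary using (¬_)
open import Relation.Binary.PropositionalEquality using (_≡_)

Subset : Set₁
Subset = ℕ → Set

_⊆_ : Subset → Subset → Set
A ⊆ B = ∀ n → A n → B n

-- Finite nonempty subsets F ⊆ A, represented as nonempty strictly increasing lists.
NonEmpty : List ℕ → Set
NonEmpty []      = ⊥
NonEmpty (_ ∷ _) = ⊤

FinSub : Subset → List ℕ → Set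
FinSub A F = NonEmpty F × Linked _<_ F × All A F

FS : Subset → Subset
FS A n = Σ (List ℕ) λ F → FinSub A F × sum F ≡ n

UniqueSums : Subset → Set
UniqueSums A = ∀ F G → FinSub A F → FinSub A G → sum F ≡ sum G → F ≡ G

-- An infinite X ⊆ ω is given by its increasing enumeration x : ℕ → ℕ.
StrictlyIncreasing : (ℕ → ℕ) → Set
StrictlyIncreasing f = ∀ i j → i < j → f i < f j

range : (ℕ → ℕ) → Subset
range x n = ∃ λ k → x k ≡ n

psum : (ℕ → ℕ) → (ℕ → ℕ) → ℕ → ℕ
psum x ns zero    = 0
psum x ns (suc m) = psum x ns m + x (ns m)

Adequate : (ℕ → ℕ) → Subset → Set
Adequate x A =
  (A ⊆ FS (range x)) ×
  (∀ (ns : ℕ → ℕ) → StrictlyIncreasing ns →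
     Σ ℕ λ m → (1 ≤ m × A (psum x ns m)) ×
       (∀ m′ → 1 ≤ m′ → A (psum x ns m′) → m′ ≡ m))

CofiniteSub : Subset → Subset → Set
CofiniteSub Y X = (Y ⊆ X) × (Σ ℕ λ N → ∀ n → X n → N ≤ n → Y n)

record Ultrafilter : Set₁ where
  field
    _∈U      : Subset → Set
    full     : (λ _ → ⊤) ∈U
    proper   : ¬ ((λ _ → ⊥) ∈U)
    upward   : ∀ {A B} → A ⊆ B → A ∈U → B ∈U
    inter    : ∀ {A B} → A ∈U → B ∈U → (λ n → A n × B n) ∈U
    ultra    : ∀ A → A ∈U ⊎ (λ n → ¬ A n) ∈U

AdequateFamily : (ℕ → ℕ) → (Subset → Set) → Set₁
AdequateFamily x 𝒰 =
  (Σ Subset λ A → Adequate x A × 𝒰 A) ×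
  (∀ (Y : Subset) → CofiniteSub Y (range x) → 𝒰 (FS Y))

AdequateUF : (ℕ → ℕ) → Ultrafilter → Set₁
AdequateUF x u = AdequateFamily x (Ultrafilter._∈U u)

⨁ : Ultrafilter → (ℕ → Ultrafilter) → Subset → Set
⨁ u us A = Ultrafilter._∈U u (λ n → Ultrafilter._∈U (us n) (λ m → A (n + m)))

{-# OPTIONS --safe #-}
module Submission where

-- Take X-adequate A ∈ u and Aₐ ∈ uₐ, and let B = Concat X A (a ↦ Aₐ) be the set of sums ΣF + ΣG
-- with F < G nonempty finite subsets of X, ΣF ∈ A and ΣG ∈ A_{ΣF}.  B ∈ ⨁ u uₙ because, for
-- a = ΣF ∈ A, the ultrafilter uₐ contains FS of the cofinite part of X above max F.  Along a
-- subsequence of X, A picks out the first m₁ terms and Aₐ, for a their sum, the next m₂ terms;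
-- by uniqueness of sums any initial sum lying in B splits into F < G along the subsequence in the
-- same way, so B picks out exactly m₁ + m₂ terms.

open import Defs
open import Data.Nat using (ℕ; zero; suc; _+_; _≤_; _<_; z≤n; s≤s)
open import Data.Nat.Properties using (≤-trans; <-≤-trans; <-trans; m≤m+n; m≤n+m; +-monoʳ-<; +-identityʳ; n<1+n)
open import Data.List using (List; []; _∷_; _++_; _∷ʳ_; [_]; applyUpTo)
open import Data.List.Properties using (applyUpTo-∷ʳ; ∷-injective)
open import Data.List.Extrema.Nat using (max; xs≤max)
open import Data.Nat.ListAction using (sum)
open import Data.Nat.ListAction.Properties using (sum-++)
open import Data.List.Relation.Unary.All as All using (All)
open import Data.List.Relation.Unary.All.Properties using (++⁺; applyUpTo⁺₁; applyUpTo⁺₂; All-swap)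
import Data.List.Relation.Unary.AllPairs.Properties as AllPairs
import Data.List.Relation.Unary.Linked.Properties as Linked
open import Data.Product using (Σ; ∃₂; _×_; _,_; proj₁; proj₂)
open import Data.Unit using (tt)
open import Function using (_∘_)
open import Relation.Binary.PropositionalEquality
  using (_≡_; refl; sym; trans; cong; cong₂; subst; subst₂; module ≡-Reasoning)

applyUpTo-+ : (f : ℕ → ℕ) (k j : ℕ) →
  applyUpTo f (k + j) ≡ applyUpTo f k ++ applyUpTo (f ∘ (k +_)) j
applyUpTo-+ f zero    j = refl
applyUpTo-+ f (suc k) j = cong (f 0 ∷_) (applyUpTo-+ (f ∘ suc) k j)

++≡applyUpTo-split : (f : ℕ → ℕ) (m : ℕ) (F G : List ℕ) → F ++ G ≡ applyUpTo f m →
  ∃₂ λ k j → m ≡ k + j × F ≡ applyUpTo f k × G ≡ applyUpTo (f ∘ (k +_)) j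
++≡applyUpTo-split f m       []      G eq = 0 , m , refl , refl , eq
++≡applyUpTo-split f (suc m) (a ∷ F) G eq with ∷-injective eq
... | refl , eq′ with ++≡applyUpTo-split (f ∘ suc) m F G eq′
...   | k , j , refl , refl , refl = suc k , j , refl , refl , refl

applyUpTo-NonEmpty : (f : ℕ → ℕ) {m : ℕ} → 1 ≤ m → NonEmpty (applyUpTo f m)
applyUpTo-NonEmpty f (s≤s z≤n) = tt

NonEmpty-applyUpTo⇒1≤ : (f : ℕ → ℕ) (m : ℕ) → NonEmpty (applyUpTo f m) → 1 ≤ m
NonEmpty-applyUpTo⇒1≤ f (suc m) _ = s≤s z≤n

Above : List ℕ → Subset → Subset
Above F Y z = Y z × All (_< z) F

FinSub-mono : {Y Z : Subset} {F : List ℕ} → Y ⊆ Z → FinSub Y F → FinSub Z F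
FinSub-mono Y⊆Z (ne , linked , all) = ne , linked , All.map (Y⊆Z _) all

FinSub-++ : {Y : Subset} (F G : List ℕ) → FinSub Y F → FinSub (Above F Y) G → FinSub Y (F ++ G)
FinSub-++ (_ ∷ _) G (_ , linkedF , allF) (_ , linkedG , allG) =
  tt ,
  Linked.AllPairs⇒Linked (AllPairs.++⁺ (Linked.Linked⇒AllPairs <-trans linkedF)
                                       (Linked.Linked⇒AllPairs <-trans linkedG)
                                       (All-swap (All.map proj₂ allG))) ,
  ++⁺ allF (All.map proj₁ allG)

FS-Above : {Y : Subset} {F : List ℕ} → FinSub Y F → FS (Above F Y) ⊆ (λ m → FS Y (sum F + m))
FS-Above {F = F} fsF m (G , fsG , refl) = F ++ G , FinSub-++ F G fsF fsG , sum-++ F G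

CofiniteSub-refl : (X : Subset) → CofiniteSub X X
CofiniteSub-refl X = (λ _ x∈X → x∈X) , 0 , λ _ x∈X _ → x∈X

CofiniteSub-Above : {Y X : Subset} (F : List ℕ) → CofiniteSub Y X → CofiniteSub (Above F Y) X
CofiniteSub-Above F (Y⊆X , N , cof) =
  (λ n → Y⊆X n ∘ proj₁) ,
  N + suc (max 0 F) ,
  λ n n∈X N+F<n → cof n n∈X (≤-trans (m≤m+n N _) N+F<n) ,
                  All.map (λ f≤max → <-≤-trans (s≤s f≤max) (≤-trans (m≤n+m _ N) N+F<n)) (xs≤max 0 F)

_∋_ : Ultrafilter → Subset → Set
u ∋ A = Ultrafilter._∈U u A

FSCofinite : Subset → (Subset → Set) → Set₁
FSCofinite X 𝒰 = ∀ Y → CofiniteSub Y X → 𝒰 (FS Y)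

⨁-FSCofinite : {X : Subset} (u : Ultrafilter) (us : ℕ → Ultrafilter) →
  FSCofinite X (u ∋_) → (∀ n → FSCofinite X (us n ∋_)) → FSCofinite X (⨁ u us)
⨁-FSCofinite u us FS∈u FS∈us Y Y-cof = Ultrafilter.upward u shift (FS∈u Y Y-cof)
  where
  shift : FS Y ⊆ (λ n → us n ∋ (λ m → FS Y (n + m)))
  shift n (F , fsF , refl) =
    Ultrafilter.upward (us n) (FS-Above fsF) (FS∈us n (Above F Y) (CofiniteSub-Above F Y-cof))

Concat : Subset → Subset → (ℕ → Subset) → Subset
Concat X A As k = Σ (List ℕ) λ F → Σ (List ℕ) λ G →
  FinSub X F × FinSub (Above F X) G × A (sum F) × As (sum F) (sum G) × sum F + sum G ≡ k

Concat⊆FS : {X A : Subset} {As : ℕ → Subset} → Concat X A As ⊆ FS X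
Concat⊆FS k (F , G , fsF , fsG , _ , _ , refl) = F ++ G , FinSub-++ F G fsF fsG , sum-++ F G

Concat-∈-⨁ : {X A : Subset} {As : ℕ → Subset} (u : Ultrafilter) (us : ℕ → Ultrafilter) →
  A ⊆ FS X → u ∋ A → (∀ a → us a ∋ As a) → (∀ a → FSCofinite X (us a ∋_)) →
  ⨁ u us (Concat X A As)
Concat-∈-⨁ {X} {A} {As} u us A⊆FS A∈u As∈us FS∈us = Ultrafilter.upward u extend A∈u
  where
  extend : A ⊆ (λ a → us a ∋ (λ b → Concat X A As (a + b)))
  extend a a∈A with A⊆FS a a∈A
  ... | F , fsF , refl =
    Ultrafilter.upward (us a) concat
      (Ultrafilter.inter (us a) (As∈us a)
        (FS∈us a (Above F X) (CofiniteSub-Above F (CofiniteSub-refl X))))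
    where
    concat : (λ b → As a b × FS (Above F X) b) ⊆ (λ b → Concat X A As (a + b))
    concat b (b∈As , G , fsG , refl) = F , G , fsF , fsG , a∈A , b∈As , refl

StrictlyIncreasing-shift : {ns : ℕ → ℕ} (k : ℕ) →
  StrictlyIncreasing ns → StrictlyIncreasing (ns ∘ (k +_))
StrictlyIncreasing-shift k ns↑ i j i<j = ns↑ _ _ (+-monoʳ-< k i<j)

SelectsUniquePrefix : (ℕ → ℕ) → Subset → (ℕ → ℕ) → Set
SelectsUniquePrefix x A ns =
  Σ ℕ λ m → (1 ≤ m × A (psum x ns m)) × (∀ m′ → 1 ≤ m′ → A (psum x ns m′) → m′ ≡ m)

module _ (x : ℕ → ℕ) (x↑ : StrictlyIncreasing x) where

  terms : (ℕ → ℕ) → ℕ → List ℕ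
  terms ns = applyUpTo (x ∘ ns)

  sum-terms : (ns : ℕ → ℕ) (m : ℕ) → sum (terms ns m) ≡ psum x ns m
  sum-terms ns zero    = refl
  sum-terms ns (suc m) = begin
    sum (terms ns (suc m))             ≡⟨ cong sum (applyUpTo-∷ʳ (x ∘ ns) m) ⟨
    sum (terms ns m ∷ʳ x (ns m))       ≡⟨ sum-++ (terms ns m) [ x (ns m) ] ⟩
    sum (terms ns m) + (x (ns m) + 0)  ≡⟨ cong₂ _+_ (sum-terms ns m) (+-identityʳ (x (ns m))) ⟩
    psum x ns m + x (ns m)             ∎
    where open ≡-Reasoning

  terms-Above : {ns : ℕ → ℕ} → StrictlyIncreasing ns → (k : ℕ) {j : ℕ} → 1 ≤ j →
    FinSub (Above (terms ns k) (range x)) (terms (ns ∘ (k +_)) j)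
  terms-Above {ns} ns↑ k {j} 1≤j =
    applyUpTo-NonEmpty _ 1≤j ,
    Linked.applyUpTo⁺₂ _ j (λ i → x↑ _ _ (ns↑ _ _ (+-monoʳ-< k (n<1+n i)))) ,
    applyUpTo⁺₂ _ j (λ i → (ns (k + i) , refl) ,
                            applyUpTo⁺₁ _ k (λ l<k → x↑ _ _ (ns↑ _ _ (<-≤-trans l<k (m≤m+n k i)))))

  terms-FinSub : {ns : ℕ → ℕ} → StrictlyIncreasing ns → {m : ℕ} → 1 ≤ m →
    FinSub (range x) (terms ns m)
  terms-FinSub ns↑ 1≤m = FinSub-mono (λ _ → proj₁) (terms-Above ns↑ 0 1≤m)

  terms-∈-Concat : {A : Subset} {As : ℕ → Subset} {ns : ℕ → ℕ} →
    StrictlyIncreasing ns → {k j : ℕ} → 1 ≤ k → 1 ≤ j → A (psum x ns k) → As (psum x ns k) (psum x (ns ∘ (k +_)) j) →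
    Concat (range x) A As (psum x ns (k + j))
  terms-∈-Concat {A} {As} {ns} ns↑ {k} {j} 1≤k 1≤j a∈A b∈As =
    F , G , terms-FinSub ns↑ 1≤k , terms-Above ns↑ k 1≤j ,
    subst A (sym (sum-terms ns k)) a∈A ,
    subst₂ As (sym (sum-terms ns k)) (sym (sum-terms (ns ∘ (k +_)) j)) b∈As ,
    sum-F+G
    where
    open ≡-Reasoning
    F G : List ℕ
    F = terms ns k
    G = terms (ns ∘ (k +_)) j
    sum-F+G : sum F + sum G ≡ psum x ns (k + j)
    sum-F+G = begin
      sum F + sum G           ≡⟨ sum-++ F G ⟨
      sum (F ++ G)            ≡⟨ cong sum (applyUpTo-+ (x ∘ ns) k j) ⟨
      sum (terms ns (k + j))  ≡⟨ sum-terms ns (k + j) ⟩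
      psum x ns (k + j)       ∎

  Concat-terms-unique : UniqueSums (range x) → {A : Subset} {As : ℕ → Subset} {ns : ℕ → ℕ} →
    StrictlyIncreasing ns → {m₁ m₂ : ℕ} →
    (∀ k → 1 ≤ k → A (psum x ns k) → k ≡ m₁) →
    (∀ j → 1 ≤ j → As (psum x ns m₁) (psum x (ns ∘ (m₁ +_)) j) → j ≡ m₂) →
    ∀ m → 1 ≤ m → Concat (range x) A As (psum x ns m) → m ≡ m₁ + m₂
  Concat-terms-unique uniq {A} {As} {ns} ns↑ unique₁ unique₂ m 1≤m
                      (F , G , fsF , fsG , a∈A , b∈As , sum≡)
    -- by uniqueness of sums, F ++ G lists the first m terms of the subsequence
    with ++≡applyUpTo-split (x ∘ ns) m F G
           (uniq (F ++ G) (terms ns m) (FinSub-++ F G fsF fsG) (terms-FinSub ns↑ 1≤m)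
                 (trans (sum-++ F G) (trans sum≡ (sym (sum-terms ns m)))))
  ... | k , j , refl , refl , refl
    with unique₁ k (NonEmpty-applyUpTo⇒1≤ _ k (proj₁ fsF)) (subst A (sum-terms ns k) a∈A)
  ... | refl = cong (k +_) (unique₂ j (NonEmpty-applyUpTo⇒1≤ _ j (proj₁ fsG))
                                      (subst₂ As (sum-terms ns k) (sum-terms (ns ∘ (k +_)) j) b∈As))

  Concat-adequate : UniqueSums (range x) → {A : Subset} {As : ℕ → Subset} →
    Adequate x A → (∀ a → Adequate x (As a)) → Adequate x (Concat (range x) A As)
  Concat-adequate uniq {A} {As} (_ , A-selects) As-select = Concat⊆FS {A = A} {As} , selects
    where
    selects : ∀ ns → StrictlyIncreasing ns → SelectsUniquePrefix x (Concat (range x) A As) ns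
    selects ns ns↑ with A-selects ns ns↑
    ... | m₁ , (1≤m₁ , a∈A) , unique₁
      with proj₂ (As-select (psum x ns m₁)) (ns ∘ (m₁ +_)) (StrictlyIncreasing-shift m₁ ns↑)
    ... | m₂ , (1≤m₂ , b∈As) , unique₂ =
      m₁ + m₂ ,
      (≤-trans 1≤m₁ (m≤m+n m₁ m₂) , terms-∈-Concat {A} {As} ns↑ 1≤m₁ 1≤m₂ a∈A b∈As) ,
      Concat-terms-unique uniq {A} {As} ns↑ unique₁ unique₂

theorem2p12 : (x : ℕ → ℕ) → StrictlyIncreasing x → UniqueSums (range x) →
    (u : Ultrafilter) (us : ℕ → Ultrafilter) →
    AdequateUF x u → (∀ n → AdequateUF x (us n)) →
    AdequateFamily x (⨁ u us)
theorem2p12 x x↑ uniq u us ((A , A-adequate , A∈u) , FS∈u) us-adequate =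
  (Concat (range x) A As ,
   Concat-adequate x x↑ uniq A-adequate As-adequate ,
   Concat-∈-⨁ u us (proj₁ A-adequate) A∈u As∈us (proj₂ ∘ us-adequate)) ,
  ⨁-FSCofinite u us FS∈u (proj₂ ∘ us-adequate)
  where
  As : ℕ → Subset
  As a = proj₁ (proj₁ (us-adequate a))
  As-adequate : ∀ a → Adequate x (As a)
  As-adequate a = proj₁ (proj₂ (proj₁ (us-adequate a)))
  As∈us : ∀ a → us a ∋ As a
  As∈us a = proj₂ (proj₂ (proj₁ (us-adequate a)))
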